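{- Let $G=(V,E)$ be a graph with $V=V_1\uplus\cdots\uplus V_k$. Construct a graph $H$ and a function $f:V(H)\to\{1,2\}$ as follows. $V(H)$ contains every vertex of $G$, new vertices $g_1,\dots,g_k$ with $g_i$ adjacent to every vertex of $V_i$, and a new vertex $g$ adjacent to every $g_i$. For every edge $e=(u,v)\in E$, add five new vertices $e_u,e_u',e_3,e_v',e_v$ and the edges $(u,e_u),(e_u,e_u'),(e_u',e_3),(e_3,e_v'),(e_v',e_v),(e_v,v)$ and $(g,e_3)$; $H$ has no other edges (in particular no edges of $G$). Let $f(e_3)=2$ for every $e\in E$, $f(g_i)=2$ for $1\le i\le k$, and $f(x)=1$ for every other vertex $x$ of $H$. Then $G$ has an independent set $S$ with $|S\cap V_i|=1$ for all $1\le i\le k$ if and only if $H$ has an $f$-valid edge coloring using at least $k+1$ colors.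
   Context: All graphs are finite, simple and undirected. An edge coloring of a graph with $m$ colors is a surjective map from its edge set onto $[m]$. For $f:V(H)\to\{1,2\}$, an edge coloring of $H$ is $f$-valid if for every vertex $v$ the edges incident to $v$ receive at most $f(v)$ distinct colors. -}

module Defs where

open import Data.Nat using (ℕ; suc)
open import Data.Fin using (Fin; _≟_)
open import Data.Fin.Subset using (Subset; _∈_; _∩_; ∣_∣)
open import Data.Vec using (tabulate)
open import Data.Product using (_×_; _,_; proj₁; proj₂; ∃)
open import Data.Sum using (_⊎_)
open import Relation.Nullary using (¬_; ⌊_⌋)
open import Relation.Binary.PropositionalEquality using (_≡_; _≢_)

-- Vertex set Fin n, partition V = V_1 ⊎ ... ⊎ V_k given by
-- part : Fin n → Fin k  (V_i = part⁻¹(i)), and m edges given by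
-- edges : Fin m → Fin n × Fin n.

record SimpleEdges (n m : ℕ) : Set where
  field
    edges    : Fin m → Fin n × Fin n
    noLoop   : ∀ e → proj₁ (edges e) ≢ proj₂ (edges e)
    distinct : ∀ e e' →
      (edges e ≡ edges e' ⊎ edges e ≡ (proj₂ (edges e') , proj₁ (edges e'))) →
      e ≡ e'
open SimpleEdges public

Adjacent : ∀ {n m} → SimpleEdges n m → Fin n → Fin n → Set
Adjacent G u v = ∃ λ e → edges G e ≡ (u , v) ⊎ edges G e ≡ (v , u)

IndependentSet : ∀ {n m} → SimpleEdges n m → Subset n → Set
IndependentSet G S = ∀ u v → u ∈ S → v ∈ S → ¬ Adjacent G u v

Part : ∀ {n k} → (Fin n → Fin k) → Fin k → Subset n
Part part i = tabulate (λ u → ⌊ part u ≟ i ⌋)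

record Graph : Set₁ where
  field
    Vtx  : Set
    Edge : Set
    ends : Edge → Vtx × Vtx
open Graph public

Incident : (H : Graph) → Vtx H → Edge H → Set
Incident H x e = x ≡ proj₁ (ends H e) ⊎ x ≡ proj₂ (ends H e)

-- an edge colouring with c colours: a surjective map E(H) → Fin c
-- (= [c]); it is f-valid if at every vertex x the incident edges
-- receive at most f x distinct colours, i.e. there are no f x + 1
-- incident edges with pairwise distinct colours.
record ValidColouring (H : Graph) (f : Vtx H → ℕ) (c : ℕ) : Set where
  field
    colour     : Edge H → Fin c
    surjective : ∀ (a : Fin c) → ∃ λ e → colour e ≡ a
    valid      : ∀ (x : Vtx H) (h : Fin (suc (f x)) → Edge H) →
                 (∀ j → Incident H x (h j)) →
                 ¬ (∀ j j' → j ≢ j' → colour (h j) ≢ colour (h j'))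

data HVtx (n k m : ℕ) : Set where
  orig : Fin n → HVtx n k m
  gv   : Fin k → HVtx n k m
  hub  : HVtx n k m
  eu   : Fin m → HVtx n k m
  eu′  : Fin m → HVtx n k m
  e3   : Fin m → HVtx n k m
  ev′  : Fin m → HVtx n k m
  ev   : Fin m → HVtx n k m

data HEdge (n k m : ℕ) : Set where
  vg    : Fin n → HEdge n k m
  gg    : Fin k → HEdge n k m
  p1 p2 p3 p4 p5 p6 p7 : Fin m → HEdge n k m

Hends : ∀ {n k m} → (Fin n → Fin k) → SimpleEdges n m →
        HEdge n k m → HVtx n k m × HVtx n k m
Hends part G (vg u) = orig u , gv (part u)
Hends part G (gg i) = hub , gv i
Hends part G (p1 e) = orig (proj₁ (edges G e)) , eu e
Hends part G (p2 e) = eu e , eu′ e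
Hends part G (p3 e) = eu′ e , e3 e
Hends part G (p4 e) = e3 e , ev′ e
Hends part G (p5 e) = ev′ e , ev e
Hends part G (p6 e) = ev e , orig (proj₂ (edges G e))
Hends part G (p7 e) = hub , e3 e

H : ∀ {n k m} → (Fin n → Fin k) → SimpleEdges n m → Graph
H {n} {k} {m} part G = record
  { Vtx = HVtx n k m ; Edge = HEdge n k m ; ends = Hends part G }

fH : ∀ {n k m} → HVtx n k m → ℕ
fH (e3 _) = 2
fH (gv _) = 2
fH _      = 1

-- Every vertex with f = 1 forces all its edges to share a colour, so each
-- gadget path u – e_u – e_u' – e_3 carries the colour of the edge (u, g_i),
-- and all edges at g carry a single colour z. At g_i at most one colour
-- besides z occurs, so a colouring with at least k + 1 colours uses
-- exactly z and one further colour per part, and every part V_i contains a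
-- vertex r_i whose edge to g_i has that colour. If r_i and r_j were
-- adjacent, e_3 would see the three distinct colours of r_i, r_j and z.
-- Conversely, an independent transversal S gives the colouring in which
-- everything near u ∈ S ∩ V_i gets colour i and everything else colour z;
-- independence leaves e_3 with at most two colours.
module Submission where

open import Defs
open import Data.Nat using (ℕ; suc; _≤_; _+_)
open import Data.Fin using (Fin)
open import Data.Fin.Subset using (Subset; _∩_; ∣_∣)
open import Data.Product using (Σ; ∃; _×_)
open import Function.Bundles using (_⇔_)
open import Relation.Binary.PropositionalEquality using (_≡_)

open import Data.Nat using (zero)
open import Data.Nat.Properties using (≤-reflexive; ≤-trans; +-comm; <⇒≱; n<1+n)
open import Data.Fin using (zero; suc; _≟_; punchIn; punchOut)
open import Data.Fin.Properties using (any?; pigeonhole; <⇒≢; injective⇒≤; punchIn-punchOut; suc-injective)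
open import Data.Fin.Subset using (_∈_; ⁅_⁆; Nonempty)
open import Data.Fin.Subset.Properties
  using (_∈?_; nonempty?; Empty-unique; ∣⊥∣≡0; x∈p∩q⁺; x∈p∩q⁻; ⊆-antisym; x∈⁅x⁆; x∈⁅y⁆⇒x≡y; ∣⁅x⁆∣≡1)
open import Data.Vec using (Vec; []; _∷_; [_]; lookup; tabulate)
open import Data.Vec.Properties using (lookup∘tabulate; []=⇒lookup; lookup⇒[]=)
open import Data.Vec.Membership.Propositional using () renaming (_∈_ to _∈ᵛ_)
open import Data.Vec.Relation.Unary.Any using (here; there; index)
open import Data.Vec.Relation.Unary.Any.Properties using (lookup-index)
open import Data.Product using (_,_; proj₁; proj₂)
open import Data.Sum using (_⊎_; inj₁; inj₂)
open import Data.Empty using (⊥)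
open import Data.Bool.Properties using (T-≡)
open import Function.Bundles using (mk⇔; Equivalence)
open import Relation.Nullary using (¬_; Dec; yes; no; ⌊_⌋; contradiction)
open import Relation.Nullary.Decidable using (toWitness; fromWitness; _×-dec_; ¬?)
open import Relation.Binary.PropositionalEquality using (_≢_; refl; sym; trans; cong; subst)

∈-tabulate-dec⁻ : ∀ {n} {P : Fin n → Set} (P? : ∀ u → Dec (P u)) {x} →
                  x ∈ tabulate (λ u → ⌊ P? u ⌋) → P x
∈-tabulate-dec⁻ P? {x} x∈ =
  toWitness (Equivalence.from T-≡
    (trans (sym (lookup∘tabulate (λ u → ⌊ P? u ⌋) x)) ([]=⇒lookup x∈)))

∈-tabulate-dec⁺ : ∀ {n} {P : Fin n → Set} (P? : ∀ u → Dec (P u)) {x} →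
                  P x → x ∈ tabulate (λ u → ⌊ P? u ⌋)
∈-tabulate-dec⁺ P? {x} px =
  lookup⇒[]= x _
    (trans (lookup∘tabulate (λ u → ⌊ P? u ⌋) x) (Equivalence.to T-≡ (fromWitness px)))

∈-Part⁻ : ∀ {n k} {part : Fin n → Fin k} {i u} → u ∈ Part part i → part u ≡ i
∈-Part⁻ {part = part} {i} = ∈-tabulate-dec⁻ (λ w → part w ≟ i)

∈-Part⁺ : ∀ {n k} {part : Fin n → Fin k} {i u} → part u ≡ i → u ∈ Part part i
∈-Part⁺ {part = part} {i} = ∈-tabulate-dec⁺ (λ w → part w ≟ i)

∣p∣≡1⇒Nonempty : ∀ {n} (p : Subset n) → ∣ p ∣ ≡ 1 → Nonempty p
∣p∣≡1⇒Nonempty {n} p ∣p∣≡1 with nonempty? p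
... | yes ne = ne
... | no empty =
  contradiction (trans (sym ∣p∣≡1) (trans (cong ∣_∣ (Empty-unique empty)) (∣⊥∣≡0 n))) λ ()

surjective⇒≤ : ∀ {n c} {h : Fin n → Fin c} → (∀ a → ∃ λ j → h j ≡ a) → c ≤ n
surjective⇒≤ {h = h} surj =
  injective⇒≤ {f = λ a → proj₁ (surj a)}
    (λ {a} {b} eq → trans (sym (proj₂ (surj a))) (trans (cong h eq) (proj₂ (surj b))))

-- If h x ≡ h y with x ≢ y, then h ∘ punchIn x is still onto Fin c, whose size exceeds its domain.
surjective⇒injective : ∀ {n c} → n ≤ c → (h : Fin n → Fin c) →
                       (∀ a → ∃ λ j → h j ≡ a) → ∀ {x y} → h x ≡ h y → x ≡ y
surjective⇒injective {suc n} n≤c h surj {x} {y} hx≡hy with x ≟ y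
... | yes x≡y = x≡y
... | no x≢y = contradiction (surjective⇒≤ surjectiveWithoutX) (<⇒≱ n≤c)
  where
  surjectiveWithoutX : ∀ a → ∃ λ w → h (punchIn x w) ≡ a
  surjectiveWithoutX a with surj a
  ... | j , hj≡a with x ≟ j
  ...   | yes refl = punchOut x≢y , trans (cong h (punchIn-punchOut x≢y)) (trans (sym hx≡hy) hj≡a)
  ...   | no x≢j = punchOut x≢j , trans (cong h (punchIn-punchOut x≢j)) hj≡a

Distinct : ∀ {A : Set} {c r} → (A → Fin c) → (Fin r → A) → Set
Distinct colour h = ∀ j j' → j ≢ j' → colour (h j) ≢ colour (h j')

module _ {A : Set} {c : ℕ} (colour : A → Fin c) where

  pairDistinct : ∀ {a b} → colour a ≢ colour b → Distinct colour (lookup (a ∷ b ∷ []))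
  pairDistinct a≢b zero zero 0≢0 = contradiction refl 0≢0
  pairDistinct a≢b zero (suc zero) _ = a≢b
  pairDistinct a≢b (suc zero) zero _ = λ eq → a≢b (sym eq)
  pairDistinct a≢b (suc zero) (suc zero) 1≢1 = contradiction refl 1≢1

  tripleDistinct : ∀ {a b d} → colour a ≢ colour b → colour a ≢ colour d → colour b ≢ colour d →
                   Distinct colour (lookup (a ∷ b ∷ d ∷ []))
  tripleDistinct a≢b a≢d b≢d zero zero 0≢0 = contradiction refl 0≢0
  tripleDistinct a≢b a≢d b≢d zero (suc zero) _ = a≢b
  tripleDistinct a≢b a≢d b≢d zero (suc (suc zero)) _ = a≢d
  tripleDistinct a≢b a≢d b≢d (suc zero) zero _ = λ eq → a≢b (sym eq)
  tripleDistinct a≢b a≢d b≢d (suc zero) (suc zero) 1≢1 = contradiction refl 1≢1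
  tripleDistinct a≢b a≢d b≢d (suc zero) (suc (suc zero)) _ = b≢d
  tripleDistinct a≢b a≢d b≢d (suc (suc zero)) zero _ = λ eq → a≢d (sym eq)
  tripleDistinct a≢b a≢d b≢d (suc (suc zero)) (suc zero) _ = λ eq → b≢d (sym eq)
  tripleDistinct a≢b a≢d b≢d (suc (suc zero)) (suc (suc zero)) 2≢2 = contradiction refl 2≢2

validColouringFromPalettes :
  (G : Graph) (f : Vtx G → ℕ) {c : ℕ} (colour : Edge G → Fin c) →
  (∀ a → ∃ λ e → colour e ≡ a) →
  (palette : ∀ x → Vec (Fin c) (f x)) →
  (∀ e → colour e ∈ᵛ palette (proj₁ (ends G e)) × colour e ∈ᵛ palette (proj₂ (ends G e))) →
  ValidColouring G f c
validColouringFromPalettes G f colour surjective palette inPalettes = record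
  { colour = colour ; surjective = surjective ; valid = valid }
  where
  inPalette : ∀ x e → Incident G x e → colour e ∈ᵛ palette x
  inPalette _ e (inj₁ refl) = proj₁ (inPalettes e)
  inPalette _ e (inj₂ refl) = proj₂ (inPalettes e)

  valid : ∀ x (h : Fin (suc (f x)) → Edge G) → (∀ j → Incident G x (h j)) → ¬ Distinct colour h
  valid x h incident distinct with pigeonhole (n<1+n (f x)) (λ j → index (inPalette x (h j) (incident j)))
  ... | i , j , i<j , sameIndex =
    distinct i j (<⇒≢ i<j) (trans (lookup-index (inPalette x (h i) (incident i)))
      (trans (cong (lookup (palette x)) sameIndex) (sym (lookup-index (inPalette x (h j) (incident j))))))

module _ {G : Graph} {f : Vtx G → ℕ} {c : ℕ} (C : ValidColouring G f c) where
  open ValidColouring C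

  validAt : ∀ {x r} → f x ≡ r → (h : Fin (suc r) → Edge G) →
            (∀ j → Incident G x (h j)) → ¬ Distinct colour h
  validAt refl = valid _

  sameColourAt : ∀ {x a b} → f x ≡ 1 → Incident G x a → Incident G x b → colour a ≡ colour b
  sameColourAt {a = a} {b} fx≡1 x∼a x∼b with colour a ≟ colour b
  ... | yes eq = eq
  ... | no a≢b = contradiction (pairDistinct colour a≢b)
                   (validAt fx≡1 (lookup (a ∷ b ∷ [])) λ { zero → x∼a ; (suc zero) → x∼b })

  twoOfThreeSameColourAt : ∀ {x a b d} → f x ≡ 2 →
    Incident G x a → Incident G x b → Incident G x d →
    colour a ≡ colour b ⊎ colour a ≡ colour d ⊎ colour b ≡ colour d
  twoOfThreeSameColourAt {a = a} {b} {d} fx≡2 x∼a x∼b x∼d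
    with colour a ≟ colour b | colour a ≟ colour d | colour b ≟ colour d
  ... | yes eq | _ | _ = inj₁ eq
  ... | no _ | yes eq | _ = inj₂ (inj₁ eq)
  ... | no _ | no _ | yes eq = inj₂ (inj₂ eq)
  ... | no a≢b | no a≢d | no b≢d =
    contradiction (tripleDistinct colour a≢b a≢d b≢d)
      (validAt fx≡2 (lookup (a ∷ b ∷ d ∷ []))
        λ { zero → x∼a ; (suc zero) → x∼b ; (suc (suc zero)) → x∼d })

endpoint₁ endpoint₂ : ∀ {n m} → SimpleEdges n m → Fin m → Fin n
endpoint₁ G e = proj₁ (edges G e)
endpoint₂ G e = proj₂ (edges G e)

module ColouringFromTransversal {n k m : ℕ} (part : Fin n → Fin (suc k)) (G : SimpleEdges n m)
  (S : Subset n) (independent : IndependentSet G S) (transversal : ∀ i → ∣ S ∩ Part part i ∣ ≡ 1) where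

  vertexColour : Fin n → Fin (suc (suc k))
  vertexColour u with u ∈? S
  ... | yes _ = suc (part u)
  ... | no _ = zero

  vertexColour-∈ : ∀ {u} → u ∈ S → vertexColour u ≡ suc (part u)
  vertexColour-∈ {u} u∈S with u ∈? S
  ... | yes _ = refl
  ... | no u∉S = contradiction u∈S u∉S

  colour : HEdge n (suc k) m → Fin (suc (suc k))
  colour (vg u) = vertexColour u
  colour (gg _) = zero
  colour (p1 e) = vertexColour (endpoint₁ G e)
  colour (p2 e) = vertexColour (endpoint₁ G e)
  colour (p3 e) = vertexColour (endpoint₁ G e)
  colour (p4 e) = vertexColour (endpoint₂ G e)
  colour (p5 e) = vertexColour (endpoint₂ G e)
  colour (p6 e) = vertexColour (endpoint₂ G e)
  colour (p7 e) = zero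

  palette : (x : HVtx n (suc k) m) → Vec (Fin (suc (suc k))) (fH x)
  palette (orig u) = [ vertexColour u ]
  palette (gv i) = zero ∷ suc i ∷ []
  palette hub = [ zero ]
  palette (eu e) = [ vertexColour (endpoint₁ G e) ]
  palette (eu′ e) = [ vertexColour (endpoint₁ G e) ]
  palette (e3 e) = vertexColour (endpoint₁ G e) ∷ vertexColour (endpoint₂ G e) ∷ []
  palette (ev′ e) = [ vertexColour (endpoint₂ G e) ]
  palette (ev e) = [ vertexColour (endpoint₂ G e) ]

  vertexColour-∈-palette-gv : ∀ u → vertexColour u ∈ᵛ palette (gv (part u))
  vertexColour-∈-palette-gv u with u ∈? S
  ... | yes _ = there (here refl)
  ... | no _ = here refl

  zero-∈-palette-e3 : ∀ e → zero ∈ᵛ palette (e3 e)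
  zero-∈-palette-e3 e with endpoint₁ G e ∈? S | endpoint₂ G e ∈? S
  ... | no _ | _ = here refl
  ... | yes _ | no _ = there (here refl)
  ... | yes u∈S | yes v∈S = contradiction (e , inj₁ refl) (independent _ _ u∈S v∈S)

  colour-∈-palettes : ∀ e → colour e ∈ᵛ palette (proj₁ (Hends part G e))
                          × colour e ∈ᵛ palette (proj₂ (Hends part G e))
  colour-∈-palettes (vg u) = here refl , vertexColour-∈-palette-gv u
  colour-∈-palettes (gg i) = here refl , here refl
  colour-∈-palettes (p1 e) = here refl , here refl
  colour-∈-palettes (p2 e) = here refl , here refl
  colour-∈-palettes (p3 e) = here refl , here refl
  colour-∈-palettes (p4 e) = there (here refl) , here refl
  colour-∈-palettes (p5 e) = here refl , here refl
  colour-∈-palettes (p6 e) = here refl , here refl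
  colour-∈-palettes (p7 e) = here refl , zero-∈-palette-e3 e

  colour-surjective : ∀ a → ∃ λ e → colour e ≡ a
  colour-surjective zero = gg zero , refl
  colour-surjective (suc i) with ∣p∣≡1⇒Nonempty (S ∩ Part part i) (transversal i)
  ... | u , u∈S∩Vᵢ with x∈p∩q⁻ S (Part part i) u∈S∩Vᵢ
  ...   | u∈S , u∈Vᵢ = vg u , trans (vertexColour-∈ u∈S) (cong suc (∈-Part⁻ u∈Vᵢ))

  colouring : ValidColouring (H part G) fH (suc (suc k))
  colouring = validColouringFromPalettes (H part G) fH colour colour-surjective palette colour-∈-palettes

module TransversalFromColouring {n k m c : ℕ} (part : Fin n → Fin (suc k)) (G : SimpleEdges n m)
  (enough : suc (suc k) ≤ c) (C : ValidColouring (H part G) fH c) where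

  open ValidColouring C

  hubColour : Fin c
  hubColour = colour (gg zero)

  vertexColour : Fin n → Fin c
  vertexColour u = colour (vg u)

  gg-colour : ∀ i → colour (gg i) ≡ hubColour
  gg-colour i = sameColourAt C {hub} refl (inj₁ refl) (inj₁ refl)

  p7-colour : ∀ e → colour (p7 e) ≡ hubColour
  p7-colour e = sameColourAt C {hub} refl (inj₁ refl) (inj₁ refl)

  p1-colour : ∀ e → colour (p1 e) ≡ vertexColour (endpoint₁ G e)
  p1-colour e = sameColourAt C {orig _} refl (inj₁ refl) (inj₁ refl)

  p2-colour : ∀ e → colour (p2 e) ≡ vertexColour (endpoint₁ G e)
  p2-colour e = trans (sameColourAt C {eu e} refl (inj₁ refl) (inj₂ refl)) (p1-colour e)

  p3-colour : ∀ e → colour (p3 e) ≡ vertexColour (endpoint₁ G e)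
  p3-colour e = trans (sameColourAt C {eu′ e} refl (inj₁ refl) (inj₂ refl)) (p2-colour e)

  p6-colour : ∀ e → colour (p6 e) ≡ vertexColour (endpoint₂ G e)
  p6-colour e = sameColourAt C {orig _} refl (inj₂ refl) (inj₁ refl)

  p5-colour : ∀ e → colour (p5 e) ≡ vertexColour (endpoint₂ G e)
  p5-colour e = trans (sameColourAt C {ev e} refl (inj₂ refl) (inj₁ refl)) (p6-colour e)

  p4-colour : ∀ e → colour (p4 e) ≡ vertexColour (endpoint₂ G e)
  p4-colour e = trans (sameColourAt C {ev′ e} refl (inj₂ refl) (inj₁ refl)) (p5-colour e)

  colour-hub-or-vertex : ∀ e → colour e ≡ hubColour ⊎ ∃ λ u → colour e ≡ vertexColour u
  colour-hub-or-vertex (vg u) = inj₂ (u , refl)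
  colour-hub-or-vertex (gg i) = inj₁ (gg-colour i)
  colour-hub-or-vertex (p1 e) = inj₂ (_ , p1-colour e)
  colour-hub-or-vertex (p2 e) = inj₂ (_ , p2-colour e)
  colour-hub-or-vertex (p3 e) = inj₂ (_ , p3-colour e)
  colour-hub-or-vertex (p4 e) = inj₂ (_ , p4-colour e)
  colour-hub-or-vertex (p5 e) = inj₂ (_ , p5-colour e)
  colour-hub-or-vertex (p6 e) = inj₂ (_ , p6-colour e)
  colour-hub-or-vertex (p7 e) = inj₁ (p7-colour e)

  NonHubIn : Fin (suc k) → Fin n → Set
  NonHubIn i u = part u ≡ i × vertexColour u ≢ hubColour

  nonHub-sameColour : ∀ {i u u'} → NonHubIn i u → NonHubIn i u' → vertexColour u ≡ vertexColour u'
  nonHub-sameColour {u = u} {u'} (refl , u≢z) (u'∈Vᵢ , u'≢z)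
    with twoOfThreeSameColourAt C {gv (part u)} {vg u} {vg u'} {gg (part u)}
           refl (inj₂ refl) (inj₂ (cong gv (sym u'∈Vᵢ))) (inj₂ refl)
  ... | inj₂ (inj₁ eq) = contradiction (trans eq (gg-colour _)) u≢z
  ... | inj₂ (inj₂ eq) = contradiction (trans eq (gg-colour _)) u'≢z
  ... | inj₁ eq = eq

  -- Defaults to the hub colour when no vertex of V_i has another colour; this is ruled out below.
  partColour : Fin (suc k) → Fin c
  partColour i with any? (λ u → (part u ≟ i) ×-dec ¬? (vertexColour u ≟ hubColour))
  ... | yes (u , _) = vertexColour u
  ... | no _ = hubColour

  partColour-spec : ∀ i → (∃ λ u → NonHubIn i u × partColour i ≡ vertexColour u)
                        ⊎ ((¬ ∃ λ u → NonHubIn i u) × partColour i ≡ hubColour)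
  partColour-spec i with any? (λ u → (part u ≟ i) ×-dec ¬? (vertexColour u ≟ hubColour))
  ... | yes (u , nonHub) = inj₁ (u , nonHub , refl)
  ... | no none = inj₂ (none , refl)

  usedColour : Fin (suc (suc k)) → Fin c
  usedColour zero = hubColour
  usedColour (suc i) = partColour i

  partColour-nonHub : ∀ {u} → vertexColour u ≢ hubColour → partColour (part u) ≡ vertexColour u
  partColour-nonHub {u} u≢z with partColour-spec (part u)
  ... | inj₁ (u' , u'-nonHub , i↦u') = trans i↦u' (nonHub-sameColour u'-nonHub (refl , u≢z))
  ... | inj₂ (none , _) = contradiction (u , refl , u≢z) none

  usedColour-surjective : ∀ a → ∃ λ j → usedColour j ≡ a
  usedColour-surjective a with a ≟ hubColour
  ... | yes a≡z = zero , sym a≡z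
  ... | no a≢z with surjective a
  ...   | e , e↦a with colour-hub-or-vertex e
  ...     | inj₁ e↦z = contradiction (trans (sym e↦a) e↦z) a≢z
  ...     | inj₂ (u , e↦u) = suc (part u) , trans (partColour-nonHub u≢z) u↦a
    where
    u↦a : vertexColour u ≡ a
    u↦a = trans (sym e↦u) e↦a

    u≢z : vertexColour u ≢ hubColour
    u≢z u↦z = a≢z (trans (sym u↦a) u↦z)

  usedColour-injective : ∀ {i j} → usedColour i ≡ usedColour j → i ≡ j
  usedColour-injective = surjective⇒injective enough usedColour usedColour-surjective

  representative-spec : ∀ i → ∃ λ u → NonHubIn i u × partColour i ≡ vertexColour u
  representative-spec i with partColour-spec i
  ... | inj₁ spec = spec
  ... | inj₂ (_ , i↦z) with usedColour-injective {suc i} {zero} i↦z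
  ...   | ()

  representative : Fin (suc k) → Fin n
  representative i = proj₁ (representative-spec i)

  representative-∈ : ∀ i → part (representative i) ≡ i
  representative-∈ i = proj₁ (proj₁ (proj₂ (representative-spec i)))

  S : Subset n
  S = tabulate (λ u → ⌊ u ≟ representative (part u) ⌋)

  ∈S⁻ : ∀ {u} → u ∈ S → u ≡ representative (part u)
  ∈S⁻ = ∈-tabulate-dec⁻ (λ u → u ≟ representative (part u))

  representative-∈S : ∀ i → representative i ∈ S
  representative-∈S i = ∈-tabulate-dec⁺ (λ u → u ≟ representative (part u))
                          (cong representative (sym (representative-∈ i)))

  S∩Vᵢ≡⁅rᵢ⁆ : ∀ i → S ∩ Part part i ≡ ⁅ representative i ⁆
  S∩Vᵢ≡⁅rᵢ⁆ i = ⊆-antisym ⊆⁅rᵢ⁆ ⁅rᵢ⁆⊆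
    where
    ⊆⁅rᵢ⁆ : ∀ {u} → u ∈ S ∩ Part part i → u ∈ ⁅ representative i ⁆
    ⊆⁅rᵢ⁆ {u} u∈S∩Vᵢ with x∈p∩q⁻ S (Part part i) u∈S∩Vᵢ
    ... | u∈S , u∈Vᵢ =
      subst (λ r → u ∈ ⁅ r ⁆) (trans (∈S⁻ u∈S) (cong representative (∈-Part⁻ u∈Vᵢ))) (x∈⁅x⁆ u)

    ⁅rᵢ⁆⊆ : ∀ {u} → u ∈ ⁅ representative i ⁆ → u ∈ S ∩ Part part i
    ⁅rᵢ⁆⊆ u∈⁅rᵢ⁆ with x∈⁅y⁆⇒x≡y (representative i) u∈⁅rᵢ⁆
    ... | refl = x∈p∩q⁺ (representative-∈S i , ∈-Part⁺ (representative-∈ i))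

  transversal : ∀ i → ∣ S ∩ Part part i ∣ ≡ 1
  transversal i = trans (cong ∣_∣ (S∩Vᵢ≡⁅rᵢ⁆ i)) (∣⁅x⁆∣≡1 (representative i))

  vertexColour-∈S : ∀ {u} → u ∈ S → vertexColour u ≡ usedColour (suc (part u))
  vertexColour-∈S {u} u∈S =
    trans (cong vertexColour (∈S⁻ u∈S)) (sym (proj₂ (proj₂ (representative-spec (part u)))))

  -- Within one part S has a single vertex, and an edge there would be a loop;
  -- across parts the three edges at e_3 would have three distinct colours.
  no-edge-within-S : ∀ e → endpoint₁ G e ∈ S → endpoint₂ G e ∈ S → ⊥
  no-edge-within-S e u∈S v∈S with part (endpoint₁ G e) ≟ part (endpoint₂ G e)
  ... | yes samePart =
    noLoop G e (trans (∈S⁻ u∈S) (trans (cong representative samePart) (sym (∈S⁻ v∈S))))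
  ... | no differentParts =
    twoColoursDiffer (twoOfThreeSameColourAt C {e3 e} refl (inj₂ refl) (inj₁ refl) (inj₂ refl))
    where
    p3↦ : colour (p3 e) ≡ usedColour (suc (part (endpoint₁ G e)))
    p3↦ = trans (p3-colour e) (vertexColour-∈S u∈S)

    p4↦ : colour (p4 e) ≡ usedColour (suc (part (endpoint₂ G e)))
    p4↦ = trans (p4-colour e) (vertexColour-∈S v∈S)

    twoColoursDiffer : colour (p3 e) ≡ colour (p4 e) ⊎ colour (p3 e) ≡ colour (p7 e)
                         ⊎ colour (p4 e) ≡ colour (p7 e) → ⊥
    twoColoursDiffer (inj₁ eq) =
      differentParts (suc-injective (usedColour-injective (trans (sym p3↦) (trans eq p4↦))))
    twoColoursDiffer (inj₂ (inj₁ eq))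
      with usedColour-injective {suc _} {zero} (trans (sym p3↦) (trans eq (p7-colour e)))
    ... | ()
    twoColoursDiffer (inj₂ (inj₂ eq))
      with usedColour-injective {suc _} {zero} (trans (sym p4↦) (trans eq (p7-colour e)))
    ... | ()

  independent : IndependentSet G S
  independent u v u∈S v∈S (e , inj₁ e≡uv) =
    no-edge-within-S e (subst (_∈ S) (sym (cong proj₁ e≡uv)) u∈S)
                       (subst (_∈ S) (sym (cong proj₂ e≡uv)) v∈S)
  independent u v u∈S v∈S (e , inj₂ e≡vu) =
    no-edge-within-S e (subst (_∈ S) (sym (cong proj₁ e≡vu)) v∈S)
                       (subst (_∈ S) (sym (cong proj₂ e≡vu)) u∈S)

mainTheorem11 : (n k m : ℕ) → 1 ≤ k → (part : Fin n → Fin k) → (G : SimpleEdges n m) →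
    (Σ (Subset n) λ S → IndependentSet G S × (∀ i → ∣ S ∩ Part part i ∣ ≡ 1))
      ⇔ (Σ ℕ λ c → (k + 1 ≤ c) × ValidColouring (H part G) fH c)
mainTheorem11 n zero m () part G
mainTheorem11 n (suc k) m _ part G = mk⇔
  (λ (S , independent , transversal) →
     suc (suc k) , ≤-reflexive (+-comm (suc k) 1) ,
     ColouringFromTransversal.colouring part G S independent transversal)
  (λ (c , k+1≤c , C) →
     let open TransversalFromColouring part G (≤-trans (≤-reflexive (+-comm 1 (suc k))) k+1≤c) C
     in S , independent , transversal)
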